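{- Let $G$ be a connected graph on $n$ vertices and let $k$ be an integer with $2\le k\le \operatorname{diam}(G)$. Then $b(G^k)\le \left\lceil \sqrt{\frac{4(k-1)}{k^2}n}\,\right\rceil$.
   Context: All graphs are finite, simple and undirected. $\operatorname{diam}(G)$ is the maximum distance between two vertices of $G$. The $k$th power $G^k$ is the graph on $V(G)$ in which distinct $u,v$ are adjacent iff $d_G(u,v)\le k$. Graph burning: in each round $i$ a vertex (source) is chosen and burned, and simultaneously every unburned neighbour of a vertex burned by the end of round $i-1$ becomes burned; burned vertices stay burned. The burning number $b(G)$ is the minimum number of rounds needed until all vertices are burned. -}

module Defs where

open import Data.Nat using (ℕ; zero; suc; _+_; _*_; _∸_; _≤_; _<_)
open import Data.Fin using (Fin)
open import Data.Empty using (⊥)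
open import Data.Sum using (_⊎_)
open import Data.Product using (Σ; ∃; ∃-syntax; _×_)
open import Relation.Nullary using (¬_)
open import Relation.Binary.PropositionalEquality using (_≡_; _≢_)

record Graph (n : ℕ) : Set₁ where
  field
    Adj   : Fin n → Fin n → Set
    sym   : ∀ {u v} → Adj u v → Adj v u
    irrefl : ∀ {u} → ¬ Adj u u

open Graph public

data Walk {n : ℕ} (R : Fin n → Fin n → Set) : Fin n → Fin n → ℕ → Set where
  here : ∀ {u} → Walk R u u 0
  step : ∀ {u w v ℓ} → R u w → Walk R w v ℓ → Walk R u v (suc ℓ)

DistLE : ∀ {n} → Graph n → Fin n → Fin n → ℕ → Set
DistLE G u v k = ∃[ ℓ ] (ℓ ≤ k × Walk (Adj G) u v ℓ)

Connected : ∀ {n} → Graph n → Set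
Connected G = ∀ u v → ∃[ ℓ ] Walk (Adj G) u v ℓ

-- k ≤ diam(G): some pair of vertices has distance ≥ k,
-- i.e. is not joined by any walk of length < k.
DiamGE : ∀ {n} → Graph n → ℕ → Set
DiamGE G k = ∃[ u ] ∃[ v ] (∀ ℓ → ℓ < k → ¬ Walk (Adj G) u v ℓ)

PowAdj : ∀ {n} → Graph n → ℕ → Fin n → Fin n → Set
PowAdj G k u v = (u ≢ v) × DistLE G u v k

-- Graph burning on an adjacency relation R.
-- `xs i` is the source chosen in round (suc i).
-- Burned xs i v : v is burned by the end of round i.
Burned : ∀ {n} → (Fin n → Fin n → Set) → (ℕ → Fin n) → ℕ → Fin n → Set
Burned R xs zero    v = ⊥
Burned R xs (suc i) v =
  Burned R xs i v
  ⊎ (∃[ u ] (Burned R xs i u × R u v))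
  ⊎ (v ≡ xs i)

BurnsIn : ∀ {n} → (Fin n → Fin n → Set) → ℕ → Set
BurnsIn R m = ∃[ xs ] (∀ v → Burned R xs m v)

BurningNumberLE : ∀ {n} → (Fin n → Fin n → Set) → ℕ → Set
BurningNumberLE R c = ∃[ m ] (m ≤ c × BurnsIn R m)

{-# OPTIONS --safe #-}
-- Root a spanning tree of G at one end u of a pair u, v at distance ≥ k; the
-- tree path from u to v shows n ≥ k + 1. Since one round of burning in G^k
-- covers k steps of G, a source lit in round c - t burns, by the end of round
-- c, everything within tree distance t·k of it. Greedily, let w be a deepest
-- vertex and put the source of largest radius r = (c-1)k at the ancestor y of
-- w at distance r (at the root if w is shallower): it burns the subtree of y,
-- which contains the r + 1 vertices of the path from w to y, and what is left
-- is again a tree containing the root. So c sources burn any tree with at most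
-- Σ_{t<c} (1 + t·k) vertices; for c ≥ 2 this sum is at least c²k²/(4(k-1)),
-- and for c ≤ 1 the hypothesis contradicts n ≥ k + 1.
module Submission where

open import Defs hiding (sym)
open import Data.Nat using (ℕ; zero; suc; _+_; _*_; _∸_; _≤_; _<_; z≤n; s≤s; z<s; _≤?_)
open import Data.Nat.Properties hiding (_≟_)
open import Data.Nat.Tactic.RingSolver using (solve-∀)
open import Data.Fin using (Fin; _≟_)
open import Data.Bool.Base using (true)
open import Data.Fin.Subset using (Subset; _∈_; _∉_; _⊆_; ⊤; ⁅_⁆; _∪_; _-_; ∁; ∣_∣)
open import Data.Fin.Subset.Properties
  using ( _∈?_; ∈⊤; ∉⊥; ⊆⊤; ⊥⊆; ⊆-antisym; ∣⊤∣≡n; ∣⊥∣≡0; ∣p∣≤n; p⊆q⇒∣p∣≤∣q∣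
        ; p⊂q⇒∣p∣<∣q∣; x∈p⇒∣p-x∣<∣p∣; x∈p∧x≢y⇒x∈p-y; p⊆p∪q; x∈p∪q⁺; x∈p∪q⁻
        ; x∈⁅x⁆; x∈⁅y⁆⇒x≡y; nonempty?; x∈∁p⇒x∉p; x∉∁p⇒x∈p)
open import Data.Vec.Base using (tabulate)
open import Data.Vec.Properties using (lookup∘tabulate; lookup⇒[]=; []=⇒lookup)
open import Data.Vec.Functional using (updateAt)
open import Data.Vec.Functional.Properties using (updateAt-updates; updateAt-minimal)
open import Data.List.Base using (filter; allFin)
import Data.List.Relation.Unary.All as All
open import Data.List.Membership.Propositional.Properties using (∈-filter⁺; ∈-filter⁻; ∈-allFin)
open import Data.List.Extrema.Nat using (argmax; argmax-sel; f[xs]≤f[argmax])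
open import Data.Sum using (_⊎_; inj₁; inj₂; [_,_])
import Data.Sum as Sum
open import Data.Product using (∃-syntax; _×_; _,_; proj₁; proj₂)
open import Function using (id; const; _∘_)
open import Relation.Unary using (Pred; Decidable)
open import Relation.Nullary using (¬_; Dec; yes; no; does; contradiction; ¬?; _×-dec_)
open import Relation.Nullary.Decidable using (dec-true; dec-false; decidable-stable)
open import Relation.Binary.PropositionalEquality
  using (_≡_; _≢_; refl; sym; trans; cong; subst; subst₂; module ≡-Reasoning)

private
  variable
    n : ℕ

subset : ∀ {ℓ} {P : Pred (Fin n) ℓ} → Decidable P → Subset n
subset P? = tabulate (does ∘ P?)

∈-subset⁺ : ∀ {ℓ} {P : Pred (Fin n) ℓ} (P? : Decidable P) {x} → P x → x ∈ subset P?
∈-subset⁺ P? {x} px = lookup⇒[]= x _ (trans (lookup∘tabulate _ x) (dec-true (P? x) px))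

∈-subset⁻ : ∀ {ℓ} {P : Pred (Fin n) ℓ} (P? : Decidable P) {x} → x ∈ subset P? → P x
∈-subset⁻ P? {x} x∈ =
  decidable-stable (P? x) λ ¬px → contradiction (trans (sym (dec-false (P? x) ¬px)) does≡true) λ ()
  where
    does≡true : does (P? x) ≡ true
    does≡true = trans (sym (lookup∘tabulate _ x)) ([]=⇒lookup x∈)

x∉p⇒∣p∣<∣p∪⁅x⁆∣ : ∀ {p : Subset n} {x} → x ∉ p → ∣ p ∣ < ∣ p ∪ ⁅ x ⁆ ∣
x∉p⇒∣p∣<∣p∪⁅x⁆∣ {x = x} x∉p = p⊂q⇒∣p∣<∣q∣ (p⊆p∪q ⁅ x ⁆ , x , x∈p∪q⁺ (inj₂ (x∈⁅x⁆ x)) , x∉p)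

x∈p∪⁅y⁆⁻ : ∀ {p : Subset n} {x y} → x ∈ p ∪ ⁅ y ⁆ → x ≡ y ⊎ x ∈ p
x∈p∪⁅y⁆⁻ {p = p} {y = y} x∈ = [ inj₂ , inj₁ ∘ x∈⁅y⁆⇒x≡y y ] (x∈p∪q⁻ p ⁅ y ⁆ x∈)

∣p∣+m≤∣q∣ : ∀ {p q : Subset n} (xs : ℕ → Fin n) m → p ⊆ q →
            (∀ {j} → j < m → xs j ∈ q × xs j ∉ p) →
            (∀ {i j} → i < j → j < m → xs i ≢ xs j) →
            ∣ p ∣ + m ≤ ∣ q ∣
∣p∣+m≤∣q∣ {p = p} xs zero p⊆q _ _ = subst (_≤ _) (sym (+-identityʳ ∣ p ∣)) (p⊆q⇒∣p∣≤∣q∣ p⊆q)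
∣p∣+m≤∣q∣ {p = p} {q} xs (suc m) p⊆q outside distinct = begin
  ∣ p ∣ + suc m    ≡⟨ +-suc ∣ p ∣ m ⟩
  suc (∣ p ∣ + m)  ≤⟨ s≤s (∣p∣+m≤∣q∣ xs m p⊆q-x outside′ distinct′) ⟩
  suc ∣ q - xs m ∣ ≤⟨ x∈p⇒∣p-x∣<∣p∣ (proj₁ (outside ≤-refl)) ⟩
  ∣ q ∣            ∎
  where
    open ≤-Reasoning
    p⊆q-x : p ⊆ q - xs m
    p⊆q-x y∈p = x∈p∧x≢y⇒x∈p-y (p⊆q y∈p) (λ { refl → proj₂ (outside ≤-refl) y∈p })
    outside′ : ∀ {j} → j < m → xs j ∈ q - xs m × xs j ∉ p
    outside′ j<m with outside (m<n⇒m<1+n j<m)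
    ... | ∈q , ∉p = x∈p∧x≢y⇒x∈p-y ∈q (distinct j<m ≤-refl) , ∉p
    distinct′ : ∀ {i j} → i < j → j < m → xs i ≢ xs j
    distinct′ i<j j<m = distinct i<j (m<n⇒m<1+n j<m)

snoc : ∀ {R : Fin n → Fin n → Set} {u w v ℓ} → Walk R u w ℓ → R w v → Walk R u v (suc ℓ)
snoc here e = step e here
snoc (step e′ W) e = step e′ (snoc W e)

DistLE-mono : ∀ (G : Graph n) {u v a b} → a ≤ b → DistLE G u v a → DistLE G u v b
DistLE-mono _ a≤b (ℓ , ℓ≤a , W) = ℓ , ≤-trans ℓ≤a a≤b , W

DistLE-split : ∀ (G : Graph n) {u v} a b → DistLE G u v (a + b) →
               ∃[ w ] (DistLE G u w a × DistLE G w v b)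
DistLE-split _ zero b d = _ , (0 , z≤n , here) , d
DistLE-split _ (suc a) b (zero , _ , here) = _ , (0 , z≤n , here) , (0 , z≤n , here)
DistLE-split G (suc a) b (suc ℓ , s≤s ℓ≤ , step e W) with DistLE-split G a b (ℓ , ℓ≤ , W)
... | w , (ℓ₁ , ℓ₁≤a , W₁) , d₂ = w , (suc ℓ₁ , s≤s ℓ₁≤a , step e W₁) , d₂

_◂_ : ∀ {a} {A : Set a} → A → (ℕ → A) → ℕ → A
(x ◂ xs) zero    = x
(x ◂ xs) (suc i) = xs i

Burned-◂ : ∀ (R : Fin n → Fin n → Set) {x xs i v} → Burned R xs i v → Burned R (x ◂ xs) (suc i) v
Burned-◂ R {i = suc i} (inj₁ b)                   = inj₁ (Burned-◂ R b)
Burned-◂ R {i = suc i} (inj₂ (inj₁ (u , b , e))) = inj₂ (inj₁ (u , Burned-◂ R b , e))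
Burned-◂ R {i = suc i} (inj₂ (inj₂ refl))        = inj₂ (inj₂ refl)

BurnsSetIn : (Fin n → Fin n → Set) → Subset n → ℕ → Set
BurnsSetIn R T m = ∃[ xs ] (∀ {v} → v ∈ T → Burned R xs m v)

module _ (G : Graph n) (k : ℕ) where

  hop : ∀ {xs i u v} → Burned (PowAdj G k) xs i u → DistLE G u v k →
        Burned (PowAdj G k) xs (suc i) v
  hop {u = u} {v} b d with u ≟ v
  ... | yes refl = inj₁ b
  ... | no u≢v   = inj₂ (inj₁ (u , b , u≢v , d))

  spread : ∀ t {xs i u v} → Burned (PowAdj G k) xs i u → DistLE G u v (t * k) →
           Burned (PowAdj G k) xs (t + i) v
  spread zero    b (_ , z≤n , here) = b
  spread (suc t) {xs} {i} {v = v} b d with DistLE-split G k (t * k) d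
  ... | _ , d₁ , d₂ = subst (λ j → Burned (PowAdj G k) xs j v) (+-suc t i) (spread t (hop b d₁) d₂)

  burned-by-first-source : ∀ m {xs v} → DistLE G (xs 0) v (m * k) → Burned (PowAdj G k) xs (suc m) v
  burned-by-first-source m {xs} {v} d =
    subst (λ j → Burned (PowAdj G k) xs j v) (+-comm m 1) (spread m (inj₂ (inj₂ refl)) d)

-- Outside B, and at the root, parent and height are unconstrained.
record TreeOn (G : Graph n) (ρ : Fin n) (B : Subset n) : Set where
  field
    parent        : Fin n → Fin n
    height        : Fin n → ℕ
    root∈         : ρ ∈ B
    height-root   : height ρ ≡ 0
    parent∈       : ∀ {v} → v ∈ B → v ≢ ρ → parent v ∈ B
    parent-edge   : ∀ {v} → v ∈ B → v ≢ ρ → Adj G (parent v) v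
    height-parent : ∀ {v} → v ∈ B → v ≢ ρ → height v ≡ suc (height (parent v))

SpanningTree : Graph n → Fin n → Set
SpanningTree G ρ = TreeOn G ρ ⊤

frontier-edge : ∀ {R : Fin n → Fin n → Set} {B u v ℓ} → Walk R u v ℓ → u ∈ B → v ∉ B →
                ∃[ a ] ∃[ b ] (a ∈ B × b ∉ B × R a b)
frontier-edge here u∈B u∉B = contradiction u∈B u∉B
frontier-edge {B = B} (step {w = w} e W) u∈B v∉B with w ∈? B
... | yes w∈B = frontier-edge W w∈B v∉B
... | no  w∉B = _ , w , u∈B , w∉B , e

module _ {G : Graph n} {ρ : Fin n} where

  rootTree : TreeOn G ρ ⁅ ρ ⁆
  rootTree = record
    { parent        = id
    ; height        = const 0
    ; root∈         = x∈⁅x⁆ ρ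
    ; height-root   = refl
    ; parent∈       = λ v∈ v≢ρ → contradiction (x∈⁅y⁆⇒x≡y ρ v∈) v≢ρ
    ; parent-edge   = λ v∈ v≢ρ → contradiction (x∈⁅y⁆⇒x≡y ρ v∈) v≢ρ
    ; height-parent = λ v∈ v≢ρ → contradiction (x∈⁅y⁆⇒x≡y ρ v∈) v≢ρ
    }

  extend : ∀ {B a b} → TreeOn G ρ B → a ∈ B → b ∉ B → Adj G a b → TreeOn G ρ (B ∪ ⁅ b ⁆)
  extend {B} {a} {b} t a∈B b∉B e = record
    { parent        = parent′
    ; height        = height′
    ; root∈         = grow root∈
    ; height-root   = trans (unchanged height root∈) height-root
    ; parent∈       = parent∈′
    ; parent-edge   = parent-edge′
    ; height-parent = height-parent′
    }
    where
      open TreeOn t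
      open ≡-Reasoning
      parent′ = updateAt parent b (const a)
      height′ = updateAt height b (const (suc (height a)))
      grow : B ⊆ B ∪ ⁅ b ⁆
      grow = p⊆p∪q ⁅ b ⁆
      unchanged : ∀ {A : Set} (f : Fin n → A) {g v} → v ∈ B → updateAt f b g v ≡ f v
      unchanged f {v = v} v∈B = updateAt-minimal v b f (λ { refl → b∉B v∈B })
      parent∈′ : ∀ {v} → v ∈ B ∪ ⁅ b ⁆ → v ≢ ρ → parent′ v ∈ B ∪ ⁅ b ⁆
      parent∈′ {v} v∈ v≢ρ with x∈p∪⁅y⁆⁻ v∈
      ... | inj₁ refl = subst (_∈ B ∪ ⁅ b ⁆) (sym (updateAt-updates b parent)) (grow a∈B)
      ... | inj₂ v∈B  = subst (_∈ B ∪ ⁅ b ⁆) (sym (unchanged parent v∈B)) (grow (parent∈ v∈B v≢ρ))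
      parent-edge′ : ∀ {v} → v ∈ B ∪ ⁅ b ⁆ → v ≢ ρ → Adj G (parent′ v) v
      parent-edge′ {v} v∈ v≢ρ with x∈p∪⁅y⁆⁻ v∈
      ... | inj₁ refl = subst (λ u → Adj G u b) (sym (updateAt-updates b parent)) e
      ... | inj₂ v∈B  = subst (λ u → Adj G u _) (sym (unchanged parent v∈B)) (parent-edge v∈B v≢ρ)
      height-parent′ : ∀ {v} → v ∈ B ∪ ⁅ b ⁆ → v ≢ ρ → height′ v ≡ suc (height′ (parent′ v))
      height-parent′ {v} v∈ v≢ρ with x∈p∪⁅y⁆⁻ v∈
      ... | inj₁ refl = begin
        height′ b                   ≡⟨ updateAt-updates b height ⟩
        suc (height a)              ≡⟨ cong suc (sym (unchanged height a∈B)) ⟩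
        suc (height′ a)             ≡⟨ cong (suc ∘ height′) (sym (updateAt-updates b parent)) ⟩
        suc (height′ (parent′ b))   ∎
      ... | inj₂ v∈B = begin
        height′ v                   ≡⟨ unchanged height v∈B ⟩
        height v                    ≡⟨ height-parent v∈B v≢ρ ⟩
        suc (height (parent v))     ≡⟨ cong suc (sym (unchanged height (parent∈ v∈B v≢ρ))) ⟩
        suc (height′ (parent v))    ≡⟨ cong (suc ∘ height′) (sym (unchanged parent v∈B)) ⟩
        suc (height′ (parent′ v))   ∎

  spanningTree-from : ∀ slack {B} → n ≤ ∣ B ∣ + slack → TreeOn G ρ B →
                      (∀ v → ∃[ ℓ ] Walk (Adj G) ρ v ℓ) → SpanningTree G ρ
  spanningTree-from slack {B} size t reach with nonempty? (∁ B)
  ... | no ∁B-empty = subst (TreeOn G ρ) (⊆-antisym ⊆⊤ ⊤⊆B) t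
    where
      ⊤⊆B : ⊤ ⊆ B
      ⊤⊆B {x} _ = x∉∁p⇒x∈p (λ x∈∁B → ∁B-empty (x , x∈∁B))
  ... | yes (v , v∈∁B) with frontier-edge (proj₂ (reach v)) (TreeOn.root∈ t) (x∈∁p⇒x∉p v∈∁B)
  ...   | a , b , a∈B , b∉B , e with slack
  ...     | zero = contradiction (≤-trans size (≤-reflexive (+-identityʳ ∣ B ∣)))
                     (<⇒≱ (<-≤-trans (x∉p⇒∣p∣<∣p∪⁅x⁆∣ b∉B) (∣p∣≤n (B ∪ ⁅ b ⁆))))
  ...     | suc slack = spanningTree-from slack size′ (extend t a∈B b∉B e) reach
    where
      size′ : n ≤ ∣ B ∪ ⁅ b ⁆ ∣ + slack
      size′ = ≤-trans size (≤-trans (≤-reflexive (+-suc ∣ B ∣ slack))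
                                    (+-monoˡ-≤ slack (x∉p⇒∣p∣<∣p∪⁅x⁆∣ b∉B)))

  spanningTree : (∀ v → ∃[ ℓ ] Walk (Adj G) ρ v ℓ) → SpanningTree G ρ
  spanningTree = spanningTree-from n (m≤n+m n _) rootTree

capacity : ℕ → ℕ → ℕ
capacity k zero    = 0
capacity k (suc m) = suc (m * k) + capacity k m

module SpanningTreeProperties {G : Graph n} {ρ : Fin n} (tree : SpanningTree G ρ) where
  open TreeOn tree public using (parent; height; height-root)

  edge : ∀ {v} → v ≢ ρ → Adj G (parent v) v
  edge = TreeOn.parent-edge tree ∈⊤

  height-suc : ∀ {v} → v ≢ ρ → height v ≡ suc (height (parent v))
  height-suc = TreeOn.height-parent tree ∈⊤

  height≡0⇒root : ∀ {v} → height v ≡ 0 → v ≡ ρ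
  height≡0⇒root {v} h≡0 with v ≟ ρ
  ... | yes v≡ρ = v≡ρ
  ... | no  v≢ρ = contradiction (trans (sym (height-suc v≢ρ)) h≡0) 1+n≢0

  below-root : ∀ {j v} → suc j ≤ height v → v ≢ ρ
  below-root {j} sj≤h refl = contradiction (subst (suc j ≤_) height-root sj≤h) λ ()

  ≤-height-parent : ∀ {j v} → suc j ≤ height v → j ≤ height (parent v)
  ≤-height-parent sj≤h = ≤-pred (subst (_ ≤_) (height-suc (below-root sj≤h)) sj≤h)

  ancestor : ℕ → Fin n → Fin n
  ancestor zero    v = v
  ancestor (suc j) v = ancestor j (parent v)

  ancestor-+ : ∀ i j v → ancestor (i + j) v ≡ ancestor j (ancestor i v)
  ancestor-+ zero    j v = refl
  ancestor-+ (suc i) j v = ancestor-+ i j (parent v)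

  height-ancestor : ∀ j {v} → j ≤ height v → height (ancestor j v) ≡ height v ∸ j
  height-ancestor zero    _    = refl
  height-ancestor (suc j) sj≤h = trans (height-ancestor j (≤-height-parent sj≤h))
                                       (cong (_∸ suc j) (sym (height-suc (below-root sj≤h))))

  ancestor-walk : ∀ j {v} → j ≤ height v → Walk (Adj G) (ancestor j v) v j
  ancestor-walk zero    _    = here
  ancestor-walk (suc j) sj≤h =
    snoc (ancestor-walk j (≤-height-parent sj≤h)) (edge (below-root sj≤h))

  ancestor-height : ∀ v → ancestor (height v) v ≡ ρ
  ancestor-height v = height≡0⇒root (trans (height-ancestor (height v) ≤-refl) (n∸n≡0 (height v)))

  root-dist : ∀ v → DistLE G ρ v (height v)
  root-dist v = height v , ≤-refl ,
    subst (λ u → Walk (Adj G) u v (height v)) (ancestor-height v) (ancestor-walk (height v) ≤-refl)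

  ancestor-injective : ∀ {i j v} → i < j → j ≤ height v → ancestor i v ≢ ancestor j v
  ancestor-injective {i} {j} {v} i<j j≤h eq = <⇒≢ i<j (∸-cancelˡ-≡ i≤h j≤h (begin
    height v ∸ i           ≡⟨ sym (height-ancestor i i≤h) ⟩
    height (ancestor i v)  ≡⟨ cong height eq ⟩
    height (ancestor j v)  ≡⟨ height-ancestor j j≤h ⟩
    height v ∸ j           ∎))
    where
      open ≡-Reasoning
      i≤h = ≤-trans (<⇒≤ i<j) j≤h

  height<n : ∀ v → height v < n
  height<n v = subst₂ _≤_ (cong (_+ suc (height v)) (∣⊥∣≡0 n)) (∣⊤∣≡n n)
    (∣p∣+m≤∣q∣ (λ j → ancestor j v) (suc (height v)) ⊥⊆ (λ _ → ∈⊤ , ∉⊥)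
               (λ i<j j≤h → ancestor-injective i<j (≤-pred j≤h)))

  AncestorClosed : Subset n → Set
  AncestorClosed T = ∀ {v} → v ∈ T → v ≢ ρ → parent v ∈ T

  ancestor-∈ : ∀ {T} → AncestorClosed T → ∀ j {v} → v ∈ T → j ≤ height v → ancestor j v ∈ T
  ancestor-∈ closed zero    v∈T _    = v∈T
  ancestor-∈ closed (suc j) v∈T sj≤h =
    ancestor-∈ closed j (closed v∈T (below-root sj≤h)) (≤-height-parent sj≤h)

  -- y is an ancestor of x iff it is the ancestor of x at the height of y;
  -- unlike ∃[ j ] ancestor j x ≡ y this is decidable.
  _≼_ : Fin n → Fin n → Set
  y ≼ x = ancestor (height x ∸ height y) x ≡ y

  _≼?_ : ∀ y x → Dec (y ≼ x)
  y ≼? x = ancestor (height x ∸ height y) x ≟ y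

  ancestor-≼ : ∀ i {x} → i ≤ height x → ancestor i x ≼ x
  ancestor-≼ i {x} i≤h = cong (λ j → ancestor j x) (begin
    height x ∸ height (ancestor i x)  ≡⟨ cong (height x ∸_) (height-ancestor i i≤h) ⟩
    height x ∸ (height x ∸ i)         ≡⟨ m∸[m∸n]≡n i≤h ⟩
    i                                 ∎)
    where open ≡-Reasoning

  ancestor-≼-ancestor : ∀ {j r w} → j ≤ r → r ≤ height w → ancestor r w ≼ ancestor j w
  ancestor-≼-ancestor {j} {r} {w} j≤r r≤h = subst (_≼ ancestor j w) climb (ancestor-≼ (r ∸ j) room)
    where
      climb : ancestor (r ∸ j) (ancestor j w) ≡ ancestor r w
      climb = trans (sym (ancestor-+ j (r ∸ j) w)) (cong (λ i → ancestor i w) (m+[n∸m]≡n j≤r))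
      room : r ∸ j ≤ height (ancestor j w)
      room = subst (r ∸ j ≤_) (sym (height-ancestor j (≤-trans j≤r r≤h))) (∸-monoˡ-≤ j r≤h)

  ≼-parent : ∀ {y v} → v ≢ ρ → y ≼ parent v → y ≼ v
  ≼-parent {y} {v} v≢ρ y≼pv = subst (_≼ v) y≼pv
    (ancestor-≼ (suc j) (subst (suc j ≤_) (sym (height-suc v≢ρ)) (s≤s (m∸n≤m _ (height y)))))
    where j = height (parent v) ∸ height y

  ≼-dist : ∀ {y v} → y ≼ v → DistLE G y v (height v ∸ height y)
  ≼-dist {y} {v} y≼v =
    _ , ≤-refl , subst (λ u → Walk (Adj G) u v _) y≼v (ancestor-walk _ (m∸n≤m _ (height y)))

  near-subtree : ∀ {v w r} → r ≤ height w → height v ≤ height w → ancestor r w ≼ v →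
                 DistLE G (ancestor r w) v r
  near-subtree {v} {w} {r} r≤h hv≤hw y≼v = DistLE-mono G bound (≼-dist y≼v)
    where
      open ≤-Reasoning
      bound : height v ∸ height (ancestor r w) ≤ r
      bound = begin
        height v ∸ height (ancestor r w)  ≤⟨ ∸-monoˡ-≤ (height (ancestor r w)) hv≤hw ⟩
        height w ∸ height (ancestor r w)  ≡⟨ cong (height w ∸_) (height-ancestor r r≤h) ⟩
        height w ∸ (height w ∸ r)         ≡⟨ m∸[m∸n]≡n r≤h ⟩
        r                                 ∎

  outside-subtree? : ∀ T y → Decidable (λ x → x ∈ T × ¬ y ≼ x)
  outside-subtree? T y x = x ∈? T ×-dec ¬? (y ≼? x)

  _∖subtree_ : Subset n → Fin n → Subset n
  T ∖subtree y = subset (outside-subtree? T y)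

  ∈-∖subtree⁺ : ∀ {T y v} → v ∈ T → ¬ y ≼ v → v ∈ T ∖subtree y
  ∈-∖subtree⁺ {T} {y} v∈T y⋠v = ∈-subset⁺ (outside-subtree? T y) (v∈T , y⋠v)

  ∈-∖subtree⁻ : ∀ {T y v} → v ∈ T ∖subtree y → v ∈ T × ¬ y ≼ v
  ∈-∖subtree⁻ {T} {y} = ∈-subset⁻ (outside-subtree? T y)

  ∖subtree-closed : ∀ {T y} → AncestorClosed T → AncestorClosed (T ∖subtree y)
  ∖subtree-closed closed v∈ v≢ρ with ∈-∖subtree⁻ v∈
  ... | v∈T , y⋠v = ∈-∖subtree⁺ (closed v∈T v≢ρ) (y⋠v ∘ ≼-parent v≢ρ)

  -- The r + 1 vertices on the path from w up to its ancestor at distance r are removed.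
  ∣∖subtree∣ : ∀ {T w r} → AncestorClosed T → w ∈ T → r ≤ height w →
               ∣ T ∖subtree ancestor r w ∣ + suc r ≤ ∣ T ∣
  ∣∖subtree∣ {T} {w} {r} closed w∈T r≤h =
    ∣p∣+m≤∣q∣ (λ j → ancestor j w) (suc r) (proj₁ ∘ ∈-∖subtree⁻) on-path distinct
    where
      y = ancestor r w
      on-path : ∀ {j} → j < suc r → ancestor j w ∈ T × ancestor j w ∉ T ∖subtree y
      on-path (s≤s j≤r) = ancestor-∈ closed _ w∈T (≤-trans j≤r r≤h)
                        , λ x∈ → proj₂ (∈-∖subtree⁻ x∈) (ancestor-≼-ancestor j≤r r≤h)
      distinct : ∀ {i j} → i < j → j < suc r → ancestor i w ≢ ancestor j w
      distinct i<j (s≤s j≤r) = ancestor-injective i<j (≤-trans j≤r r≤h)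

  deepest : (T : Subset n) → ∃[ w ] ((w ≡ ρ ⊎ w ∈ T) × (∀ {v} → v ∈ T → height v ≤ height w))
  deepest T = w , w∈ , deeper
    where
      members = filter (_∈? T) (allFin _)
      w = argmax height ρ members
      w∈ : w ≡ ρ ⊎ w ∈ T
      w∈ = Sum.map₂ (proj₂ ∘ ∈-filter⁻ (_∈? T) {xs = allFin n}) (argmax-sel height ρ members)
      deeper : ∀ {v} → v ∈ T → height v ≤ height w
      deeper v∈T = All.lookup (f[xs]≤f[argmax] ρ members) (∈-filter⁺ (_∈? T) (∈-allFin _) v∈T)

  burnable : ∀ k m {T} → AncestorClosed T → ∣ T ∣ ≤ capacity k m → BurnsSetIn (PowAdj G k) T m
  burnable k zero _ size = const ρ , λ v∈T → contradiction (≤-trans (x∈p⇒∣p-x∣<∣p∣ v∈T) size) λ ()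
  burnable k (suc m) {T} closed size with deepest T
  ... | w , w∈ , deeper with height w ≤? m * k
  ...   | yes shallow = const ρ , λ {v} v∈T →
          burned-by-first-source G k m (DistLE-mono G (≤-trans (deeper v∈T) shallow) (root-dist v))
  ...   | no deep = ancestor r w ◂ proj₁ rest , burns
    where
      r = m * k
      r<h : r < height w
      r<h = ≰⇒> deep
      w∈T : w ∈ T
      w∈T = [ (λ { refl → contradiction (subst (r <_) height-root r<h) λ () }) , id ] w∈
      rest : BurnsSetIn (PowAdj G k) (T ∖subtree ancestor r w) m
      rest = burnable k m (∖subtree-closed closed) (+-cancelʳ-≤ (suc r) _ _ (begin
        ∣ T ∖subtree ancestor r w ∣ + suc r  ≤⟨ ∣∖subtree∣ closed w∈T (<⇒≤ r<h) ⟩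
        ∣ T ∣                                ≤⟨ size ⟩
        suc r + capacity k m                 ≡⟨ +-comm (suc r) _ ⟩
        capacity k m + suc r                 ∎))
        where open ≤-Reasoning
      burns : ∀ {v} → v ∈ T → Burned (PowAdj G k) (ancestor r w ◂ proj₁ rest) (suc m) v
      burns {v} v∈T with ancestor r w ≼? v
      ... | yes y≼v = burned-by-first-source G k m (near-subtree (<⇒≤ r<h) (deeper v∈T) y≼v)
      ... | no  y⋠v = Burned-◂ (PowAdj G k) (proj₂ rest (∈-∖subtree⁺ v∈T y⋠v))

double-capacity : ∀ k m → 2 * capacity k m + k * m ≡ k * m * m + 2 * m
double-capacity k zero    = base k
  where
    base : ∀ k → 2 * 0 + k * 0 ≡ k * 0 * 0 + 2 * 0
    base = solve-∀
double-capacity k (suc m) = begin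
  2 * capacity k (suc m) + k * suc m      ≡⟨ unfold k m (capacity k m) ⟩
  (2 * capacity k m + k * m) + increment  ≡⟨ cong (_+ increment) (double-capacity k m) ⟩
  (k * m * m + 2 * m) + increment         ≡⟨ close k m ⟩
  k * suc m * suc m + 2 * suc m           ∎
  where
    open ≡-Reasoning
    increment = 2 + 2 * (m * k) + k
    unfold : ∀ k m S → 2 * (suc (m * k) + S) + k * suc m
                       ≡ (2 * S + k * m) + (2 + 2 * (m * k) + k)
    unfold = solve-∀
    close : ∀ k m → (k * m * m + 2 * m) + (2 + 2 * (m * k) + k)
                    ≡ k * suc m * suc m + 2 * suc m
    close = solve-∀

-- 4(k-1)·capacity k c - c²k² = c(k-2)((c-2)k+2), which is negative for c = 1.
c²k²≤4[k-1]capacity : ∀ c k → 2 ≤ c → 2 ≤ k → c * c * (k * k) ≤ 4 * (k ∸ 1) * capacity k c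
c²k²≤4[k-1]capacity c@(suc (suc c′)) k@(suc (suc k′)) (s≤s (s≤s z≤n)) (s≤s (s≤s z≤n)) =
  +-cancelʳ-≤ (2 * suc k′ * (k * c)) _ _ (begin
    c * c * (k * k) + 2 * suc k′ * (k * c)                          ≤⟨ m≤m+n _ _ ⟩
    c * c * (k * k) + 2 * suc k′ * (k * c) + c * k′ * (c′ * k + 2)  ≡⟨ expand c′ k′ ⟩
    2 * suc k′ * (k * c * c + 2 * c)                                ≡⟨ cong (2 * suc k′ *_) (double-capacity k c) ⟨
    2 * suc k′ * (2 * S + k * c)                                    ≡⟨ distribute k′ S (k * c) ⟩
    4 * suc k′ * S + 2 * suc k′ * (k * c)                           ∎)
  where
    open ≤-Reasoning
    S = capacity k c
    expand : ∀ c′ k′ → let c = 2 + c′; k = 2 + k′ in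
             c * c * (k * k) + 2 * suc k′ * (k * c) + c * k′ * (c′ * k + 2)
             ≡ 2 * suc k′ * (k * c * c + 2 * c)
    expand = solve-∀
    distribute : ∀ k′ S x → 2 * suc k′ * (2 * S + x) ≡ 4 * suc k′ * S + 2 * suc k′ * x
    distribute = solve-∀

k²<4[k-1][k+1] : ∀ k → 2 ≤ k → k * k < 4 * (k ∸ 1) * suc k
k²<4[k-1][k+1] k@(suc (suc k′)) (s≤s (s≤s z≤n)) = begin-strict
  k * k                                    <⟨ m<m+n (k * k) z<s ⟩
  k * k + suc (7 + 12 * k′ + 3 * k′ * k′)  ≡⟨ expand k′ ⟩
  4 * suc k′ * suc k                       ∎
  where
    open ≤-Reasoning
    expand : ∀ k′ → let k = 2 + k′ in k * k + suc (7 + 12 * k′ + 3 * k′ * k′) ≡ 4 * suc k′ * suc k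
    expand = solve-∀

too-few-sources : ∀ {k n} c → c ≤ 1 → 2 ≤ k → k < n → c * c * (k * k) < 4 * (k ∸ 1) * n
too-few-sources {k} {n} c c≤1 2≤k k<n = begin-strict
  c * c * (k * k)      ≤⟨ *-monoˡ-≤ (k * k) (*-mono-≤ c≤1 c≤1) ⟩
  1 * 1 * (k * k)      ≡⟨ *-identityˡ (k * k) ⟩
  k * k                <⟨ k²<4[k-1][k+1] k 2≤k ⟩
  4 * (k ∸ 1) * suc k  ≤⟨ *-monoʳ-≤ (4 * (k ∸ 1)) k<n ⟩
  4 * (k ∸ 1) * n      ∎
  where open ≤-Reasoning

n≤capacity : ∀ {k n} c → 2 ≤ k → k < n → 4 * (k ∸ 1) * n ≤ c * c * (k * k) → n ≤ capacity k c
n≤capacity {k} c 2≤k@(s≤s (s≤s _)) k<n bound with c ≤? 1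
... | yes c≤1 = contradiction bound (<⇒≱ (too-few-sources c c≤1 2≤k k<n))
... | no  c≰1 = *-cancelˡ-≤ (4 * (k ∸ 1)) (≤-trans bound (c²k²≤4[k-1]capacity c k (≰⇒> c≰1) 2≤k))

theorem9 : ∀ {n : ℕ} (G : Graph n) (k : ℕ) → Connected G → 2 ≤ k → DiamGE G k
           → ∀ (c : ℕ) → 4 * (k ∸ 1) * n ≤ (c * c) * (k * k)
           → BurningNumberLE (PowAdj G k) c
theorem9 {n} G k connected 2≤k (u , v , far) c bound =
  c , ≤-refl , proj₁ burning , λ _ → proj₂ burning ∈⊤
  where
    open SpanningTreeProperties (spanningTree {G = G} (connected u))
    k≤height : k ≤ height v
    k≤height with root-dist v
    ... | ℓ , ℓ≤h , W = ≤-trans (≮⇒≥ λ ℓ<k → far ℓ ℓ<k W) ℓ≤h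
    k<n : k < n
    k<n = ≤-<-trans k≤height (height<n v)
    burning : BurnsSetIn (PowAdj G k) ⊤ c
    burning = burnable k c (λ _ _ → ∈⊤)
      (subst (_≤ capacity k c) (sym (∣⊤∣≡n n)) (n≤capacity c 2≤k k<n bound))
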